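{- Let $G=(V_B\cup V_R,E)$ be a bipartite graph with blue vertices $V_B$ and red vertices $V_R$ such that no blue vertex $b$ satisfies $N(b)\subseteq N(b')$ for another blue vertex $b'$, and no red vertex $r$ satisfies $N(r)\supseteq N(r')$ for another red vertex $r'$. Let $v\in V_B$ with $|P(v)|\geq 1$, and let $G'$ be obtained from $G$ by removing $v$ and all vertices of $N(v)$. Then $G$ has a red-blue dominating set of size at most $k$ if and only if $G'$ has a red-blue dominating set of size at most $k-1$.
   Context: $N(v)=\{u:\{u,v\}\in E\}$. For a blue vertex $b$, its private neighborhood is $P(b)=\{r\in N(b): N(N(r))\subseteq N(b)\}$, where $N(S)=\bigcup_{s\in S}N(s)$. A red-blue dominating set of $G$ is a set $D\subseteq V_B$ such that every red vertex is adjacent to a vertex of $D$. -}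

module Defs where

open import Data.Nat using (ℕ; _≤_; _+_)
open import Data.Bool using (Bool; true; false)
open import Data.Fin using (Fin)
open import Data.Fin.Subset using (Subset; _∈_; _∉_; _⊆_; _⊇_; ∣_∣; ⁅_⁆; ∁)
open import Data.Fin.Subset.Properties using (_∈?_; _⊆?_)
open import Data.Fin.Properties using (any?)
open import Data.Vec using (tabulate)
open import Data.Product using (Σ; _×_; ∃)
open import Relation.Binary.PropositionalEquality using (_≡_)
open import Relation.Nullary using (¬_)
open import Relation.Nullary.Decidable using (⌊_⌋; _×-dec_)
open import Data.Bool.Properties using () renaming (_≟_ to _≟ᵇ_)

-- A finite bipartite graph: blue vertices Fin nB, red vertices Fin nR,
-- edge indicator adj b r = true iff {b,r} ∈ E.
record BipGraph : Set where
  field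
    nB  : ℕ
    nR  : ℕ
    adj : Fin nB → Fin nR → Bool

module _ (G : BipGraph) where
  open BipGraph G

  Adj : Fin nB → Fin nR → Set
  Adj b r = adj b r ≡ true

  NB : Fin nB → Subset nR
  NB b = tabulate λ r → adj b r

  NR : Fin nR → Subset nB
  NR r = tabulate λ b → adj b r

  NofReds : Subset nR → Subset nB
  NofReds S = tabulate λ b → ⌊ any? (λ r → (r ∈? S) ×-dec (adj b r ≟ᵇ true)) ⌋

  NofBlues : Subset nB → Subset nR
  NofBlues S = tabulate λ r → ⌊ any? (λ b → (b ∈? S) ×-dec (adj b r ≟ᵇ true)) ⌋

  P : Fin nB → Subset nR
  P b = tabulate λ r → ⌊ (r ∈? NB b) ×-dec (NofBlues (NR r) ⊆? NB b) ⌋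

  IsRBDomSetOn : Subset nB → Subset nR → Subset nB → Set
  IsRBDomSetOn Bs Rs D = D ⊆ Bs × (∀ r → r ∈ Rs → ∃ λ b → b ∈ D × Adj b r)

  IsRBDomSet : Subset nB → Set
  IsRBDomSet D = ∀ r → ∃ λ b → b ∈ D × Adj b r

  NoDominatedBlue : Set
  NoDominatedBlue = ∀ (b b' : Fin nB) → ¬ (b ≡ b') → ¬ (NB b ⊆ NB b')

  NoDominatingRed : Set
  NoDominatingRed = ∀ (r r' : Fin nR) → ¬ (r ≡ r') → ¬ (NR r ⊇ NR r')

  -- G' = G − ({v} ∪ N(v)): blue vertices all but v, red vertices all outside N(v)
  IsRBDomSetRemoved : Fin nB → Subset nB → Set
  IsRBDomSetRemoved v D = IsRBDomSetOn (∁ ⁅ v ⁆) (∁ (NB v)) D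

-- If r is a private neighbour of v, every blue neighbour b of r satisfies
-- N(b) ⊆ N(N(r)) ⊆ N(v), so b = v because no blue vertex is dominated by
-- another. Hence every red-blue dominating set contains v, and removing v
-- leaves a dominating set of G' (the reds outside N(v) were dominated by
-- vertices other than v). Conversely, adding v to a dominating set of G'
-- dominates N(v) as well.
module Submission where

open import Defs
open import Data.Nat using (ℕ; _≤_; _<_; _+_; z≤n; s≤s)
open import Data.Nat.Properties using (≤-trans; ≤-reflexive; +-comm; +-suc; +-monoʳ-≤)
open import Data.Bool using (Bool; true)
open import Data.Bool.Properties using (T-≡)
open import Data.Fin using (Fin; zero; suc) renaming (_≟_ to _≟ᶠ_)
open import Data.Fin.Subset using (Subset; Nonempty; inside; outside; ∣_∣; _∈_; _∉_; _⊆_; _∪_; _─_; _-_; ⁅_⁆; ∁)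
open import Data.Fin.Subset.Properties using (_∈?_; ∣p∣≤∣x∷p∣; ∣⁅x⁆∣≡1; x∈⁅x⁆; x∈⁅y⁆⇒x≡y; x∈∁p⇒x∉p; x∉p⇒x∈∁p; x∈p∪q⁺; x∈p∧x∉q⇒x∈p─q; x∈p⇒∣p-x∣<∣p∣)
open import Data.Product using (∃; _×_; _,_; proj₂)
open import Data.Sum using (inj₁; inj₂)
open import Data.Empty using (⊥-elim)
open import Data.Vec using (tabulate; _∷_; []; here; there)
open import Data.Vec.Properties using (lookup∘tabulate; []=⇒lookup; lookup⇒[]=)
open import Function.Bundles using (_⇔_; mk⇔; Equivalence)
open import Relation.Nullary using (Dec; yes; no)
open import Relation.Nullary.Decidable using (⌊_⌋; toWitness; fromWitness)
open import Relation.Binary.PropositionalEquality using (_≡_; refl; sym; trans; subst)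

∈-tabulate : ∀ {n} (f : Fin n → Bool) {x} → x ∈ tabulate f ⇔ f x ≡ true
∈-tabulate f {x} = mk⇔
  (λ x∈ → trans (sym (lookup∘tabulate f x)) ([]=⇒lookup x∈))
  (λ fx → lookup⇒[]= x _ (trans (lookup∘tabulate f x) fx))

≡true⇔witness : ∀ {a} {A : Set a} (a? : Dec A) → ⌊ a? ⌋ ≡ true ⇔ A
≡true⇔witness a? = mk⇔
  (λ e → toWitness (Equivalence.from T-≡ e))
  (λ a → Equivalence.to T-≡ (fromWitness a))

0<∣p∣⇒Nonempty : ∀ {n} (p : Subset n) → 0 < ∣ p ∣ → Nonempty p
0<∣p∣⇒Nonempty (inside  ∷ p) _   = zero , here
0<∣p∣⇒Nonempty (outside ∷ p) 0<∣p∣ with 0<∣p∣⇒Nonempty p 0<∣p∣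
... | x , x∈p = suc x , there x∈p

x∈p─q⇒x∉q : ∀ {n} (p q : Subset n) {x} → x ∈ p ─ q → x ∉ q
x∈p─q⇒x∉q (_ ∷ p) (outside ∷ q) here        ()
x∈p─q⇒x∉q (_ ∷ p) (_       ∷ q) (there x∈) (there x∈q) = x∈p─q⇒x∉q p q x∈ x∈q

∣p∪q∣≤∣p∣+∣q∣ : ∀ {n} (p q : Subset n) → ∣ p ∪ q ∣ ≤ ∣ p ∣ + ∣ q ∣
∣p∪q∣≤∣p∣+∣q∣ []            []            = z≤n
∣p∪q∣≤∣p∣+∣q∣ (inside  ∷ p) (s       ∷ q) =
  s≤s (≤-trans (∣p∪q∣≤∣p∣+∣q∣ p q) (+-monoʳ-≤ ∣ p ∣ (∣p∣≤∣x∷p∣ s q)))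
∣p∪q∣≤∣p∣+∣q∣ (outside ∷ p) (inside  ∷ q) =
  ≤-trans (s≤s (∣p∪q∣≤∣p∣+∣q∣ p q)) (≤-reflexive (sym (+-suc ∣ p ∣ ∣ q ∣)))
∣p∪q∣≤∣p∣+∣q∣ (outside ∷ p) (outside ∷ q) = ∣p∪q∣≤∣p∣+∣q∣ p q

∣p-x∣+1≤∣p∣ : ∀ {n} {p : Subset n} {x} → x ∈ p → ∣ p - x ∣ + 1 ≤ ∣ p ∣
∣p-x∣+1≤∣p∣ {p = p} {x} x∈p =
  subst (_≤ ∣ p ∣) (+-comm 1 ∣ p - x ∣) (x∈p⇒∣p-x∣<∣p∣ x∈p)

∣p∪⁅x⁆∣≤∣p∣+1 : ∀ {n} (p : Subset n) x → ∣ p ∪ ⁅ x ⁆ ∣ ≤ ∣ p ∣ + 1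
∣p∪⁅x⁆∣≤∣p∣+1 p x =
  subst (λ m → ∣ p ∪ ⁅ x ⁆ ∣ ≤ ∣ p ∣ + m) (∣⁅x⁆∣≡1 x) (∣p∪q∣≤∣p∣+∣q∣ p ⁅ x ⁆)

module _ (G : BipGraph) where
  open BipGraph G

  ∈NB⇔Adj : ∀ {b r} → r ∈ NB G b ⇔ Adj G b r
  ∈NB⇔Adj {b} = ∈-tabulate (adj b)

  ∈NR⇔Adj : ∀ {b r} → b ∈ NR G r ⇔ Adj G b r
  ∈NR⇔Adj {r = r} = ∈-tabulate (λ b → adj b r)

  ∈NofBlues⁺ : ∀ {S b r} → b ∈ S → Adj G b r → r ∈ NofBlues G S
  ∈NofBlues⁺ {b = b} b∈S b~r =
    Equivalence.from (∈-tabulate _) (Equivalence.from (≡true⇔witness _) (b , b∈S , b~r))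

  ∈P⁻ : ∀ {v r} → r ∈ P G v → r ∈ NB G v × NofBlues G (NR G r) ⊆ NB G v
  ∈P⁻ r∈P = Equivalence.to (≡true⇔witness _) (Equivalence.to (∈-tabulate _) r∈P)

  private-neighbour-dominators⊆ : ∀ {v r b} → r ∈ P G v → Adj G b r → NB G b ⊆ NB G v
  private-neighbour-dominators⊆ r∈P b~r r'∈Nb =
    proj₂ (∈P⁻ r∈P) (∈NofBlues⁺ (Equivalence.from ∈NR⇔Adj b~r) (Equivalence.to ∈NB⇔Adj r'∈Nb))

  private-neighbour-dominated-only-by-owner :
    NoDominatedBlue G → ∀ {v r b} → r ∈ P G v → Adj G b r → b ≡ v
  private-neighbour-dominated-only-by-owner noDominated {v} {b = b} r∈P b~r with b ≟ᶠ v
  ... | yes b≡v = b≡v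
  ... | no  b≢v = ⊥-elim (noDominated b v b≢v (private-neighbour-dominators⊆ r∈P b~r))

  private-neighbour-owner-∈-dominating-set :
    NoDominatedBlue G → ∀ {v r D} → r ∈ P G v → IsRBDomSet G D → v ∈ D
  private-neighbour-owner-∈-dominating-set noDominated {r = r} {D} r∈P dom with dom r
  ... | b , b∈D , b~r =
    subst (_∈ D) (private-neighbour-dominated-only-by-owner noDominated r∈P b~r) b∈D

  IsRBDomSet⇒IsRBDomSetRemoved- : ∀ {D} v → IsRBDomSet G D → IsRBDomSetRemoved G v (D - v)
  IsRBDomSet⇒IsRBDomSetRemoved- {D} v dom = D-v⊆∁⁅v⁆ , dominates-∁Nv
    where
    D-v⊆∁⁅v⁆ : D - v ⊆ ∁ ⁅ v ⁆
    D-v⊆∁⁅v⁆ x∈ = x∉p⇒x∈∁p (x∈p─q⇒x∉q D ⁅ v ⁆ x∈)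

    dominates-∁Nv : ∀ r → r ∈ ∁ (NB G v) → ∃ λ b → b ∈ D - v × Adj G b r
    dominates-∁Nv r r∉Nv with dom r
    ... | b , b∈D , b~r = b , x∈p∧x∉q⇒x∈p─q b∈D b∉⁅v⁆ , b~r
      where
      b∉⁅v⁆ : b ∉ ⁅ v ⁆
      b∉⁅v⁆ b∈⁅v⁆ with x∈⁅y⁆⇒x≡y v b∈⁅v⁆
      ... | refl = x∈∁p⇒x∉p r∉Nv (Equivalence.from ∈NB⇔Adj b~r)

  IsRBDomSetRemoved⇒IsRBDomSet-∪ : ∀ {D} v → IsRBDomSetRemoved G v D → IsRBDomSet G (D ∪ ⁅ v ⁆)
  IsRBDomSetRemoved⇒IsRBDomSet-∪ v (_ , dom) r with r ∈? NB G v
  ... | yes r∈Nv = v , x∈p∪q⁺ (inj₂ (x∈⁅x⁆ v)) , Equivalence.to ∈NB⇔Adj r∈Nv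
  ... | no  r∉Nv with dom r (x∉p⇒x∈∁p r∉Nv)
  ... | b , b∈D , b~r = b , x∈p∪q⁺ (inj₁ b∈D) , b~r

lemma2 : (G : BipGraph) → NoDominatedBlue G → NoDominatingRed G →
    (v : Fin (BipGraph.nB G)) → 1 ≤ ∣ P G v ∣ → (k : ℕ) →
    (∃ λ (D : Subset (BipGraph.nB G)) → IsRBDomSet G D × ∣ D ∣ ≤ k) ⇔
    (∃ λ (D : Subset (BipGraph.nB G)) → IsRBDomSetRemoved G v D × ∣ D ∣ + 1 ≤ k)
lemma2 G noDominated _ v 0<∣Pv∣ k with 0<∣p∣⇒Nonempty (P G v) 0<∣Pv∣
... | _ , r∈Pv = mk⇔ shrink grow
  where
  shrink : ∃ (λ D → IsRBDomSet G D × ∣ D ∣ ≤ k) → ∃ (λ D → IsRBDomSetRemoved G v D × ∣ D ∣ + 1 ≤ k)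
  shrink (D , dom , ∣D∣≤k) =
    D - v , IsRBDomSet⇒IsRBDomSetRemoved- G v dom
          , ≤-trans (∣p-x∣+1≤∣p∣ (private-neighbour-owner-∈-dominating-set G noDominated r∈Pv dom)) ∣D∣≤k

  grow : ∃ (λ D → IsRBDomSetRemoved G v D × ∣ D ∣ + 1 ≤ k) → ∃ (λ D → IsRBDomSet G D × ∣ D ∣ ≤ k)
  grow (D , dom , ∣D∣+1≤k) =
    D ∪ ⁅ v ⁆ , IsRBDomSetRemoved⇒IsRBDomSet-∪ G v dom , ≤-trans (∣p∪⁅x⁆∣≤∣p∣+1 D v) ∣D∣+1≤k
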